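{- Let $s \ge 0$ be an integer. Every bar $s$-visibility hypergraph with $n$ vertices has at most $(2s+3)n$ edges.
   Context: A bar $s$-visibility hypergraph is defined from a finite collection of pairwise disjoint horizontal bars (closed horizontal segments) in the plane: its vertices are the bars, and its edges are the (distinct) subsets of exactly $s+2$ bars for which there exists a vertical segment that intersects exactly the bars in that subset and no other bar.
   Formalization: The bars and the vertical segments have rational coordinates rather than arbitrary real ones. -}

module Defs where

open import Data.Nat using (ℕ; _+_; _*_)
open import Data.Fin using (Fin)
open import Data.Fin.Subset using (Subset; _∈_; ∣_∣)
open import Data.Rational using (ℚ; _≤_; _<_)
open import Data.Product using (_×_; Σ)
open import Data.Sum using (_⊎_)
open import Data.List using (List; length)
open import Data.List.Relation.Unary.All using (All)
open import Data.List.Relation.Unary.Unique.Propositional using (Unique)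
open import Relation.Binary.PropositionalEquality using (_≡_; _≢_)
open import Relation.Nullary using (¬_)

record Bar : Set where
  field
    height : ℚ
    left   : ℚ
    right  : ℚ
    left<right : left < right
open Bar public

Disjoint : Bar → Bar → Set
Disjoint a b = ¬ (height a ≡ height b) ⊎ (right a < left b ⊎ right b < left a)

record BarCollection (n : ℕ) : Set where
  field
    bar : Fin n → Bar
    pairwiseDisjoint : ∀ i j → i ≢ j → Disjoint (bar i) (bar j)
open BarCollection public

record VSeg : Set where
  field
    x      : ℚ
    bottom : ℚ
    top    : ℚ
    bottom≤top : bottom ≤ top
open VSeg public

Meets : VSeg → Bar → Set
Meets σ b = (left b ≤ x σ × x σ ≤ right b) × (bottom σ ≤ height b × height b ≤ top σ)

IsEdge : ∀ {n} → ℕ → BarCollection n → Subset n → Set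
IsEdge {n} s B S =
  (∣ S ∣ ≡ s + 2) ×
  Σ VSeg (λ σ → ∀ (i : Fin n) → (i ∈ S → Meets σ (bar B i)) × (Meets σ (bar B i) → i ∈ S))

{-# OPTIONS --safe #-}

-- Push the vertical segment witnessing an edge S to the left. Let a be the bar of S whose
-- left end is rightmost, and call a bar a blocker if it ends left of the segment at a height
-- between two bars of S. If no blocker reaches the left end of a, then at that abscissa S is
-- still a block of consecutive bars (in height order) of the bars over that point; otherwise
-- the same holds just right of the blocker c that ends rightmost. Charge S to a or to c,
-- together with the number of bars of S below it: s + 2 possible values for a, but only
-- s + 1 for c, because c is disjoint from the bars of S over its right end, so its height
-- lies strictly between two of them. A block of consecutive bars over a point is determined
-- by its size and by how many of its bars lie below a height within its range, so every bar
-- is charged at most (s + 2) + (s + 1) times.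

module Submission where

open import Level using (0ℓ)
open import Data.Nat using (ℕ; zero; suc; _+_; _*_; _≤_; _<_; s<s⁻¹)
import Data.Nat.Properties as ℕ
open import Data.Fin using (Fin; zero; suc; toℕ; fromℕ<)
open import Data.Fin.Properties using (any?; injective⇒≤; toℕ-fromℕ<; +↔⊎; *↔×)
open import Data.Fin.Subset using (Subset; _∈_; _∉_; _⊆_; _∩_; ∁; ∣_∣)
open import Data.Fin.Subset.Properties
  using (_∈?_; ⊆-antisym; p⊂q⇒∣p∣<∣q∣; p∩q⊆p; x∈p∩q⁺; x∈p∩q⁻;
         x∉p⇒x∈∁p; x∈∁p⇒x∉p; ⊥⊆; ∉⊥; ∣⊥∣≡0; Empty-unique)
open import Data.Rational using (ℚ) renaming (_≤_ to _≤ℚ_; _<_ to _<ℚ_; _<?_ to _<ℚ?_; _≤?_ to _≤ℚ?_)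
import Data.Rational.Properties as ℚ
open import Data.Vec using (tabulate)
open import Data.Vec.Properties using (lookup∘tabulate; []=⇒lookup; lookup⇒[]=)
open import Data.Product using (_×_; _,_; proj₁; proj₂; ∃)
open import Data.Product.Function.NonDependent.Propositional using (_×-↔_)
open import Data.Sum as Sum using (_⊎_; inj₁; inj₂)
open import Data.List using (List; length; lookup)
open import Data.List.Membership.Propositional.Properties using (∈-lookup)
open import Data.List.Relation.Unary.All as All using (All)
open import Data.List.Relation.Unary.AllPairs using (_∷_)
open import Data.List.Relation.Unary.Unique.Propositional using (Unique)
open import Function using (_∘_; flip; _↔_; Inverse; Injection; Injective)
open import Function.Properties.Inverse using (↔-refl; ↔-sym; ↔-trans; ↔⇒↣)
open import Relation.Binary using (Rel; Total)
open import Relation.Binary.PropositionalEquality using (_≡_; _≢_; refl; sym; trans; cong; subst)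
open import Relation.Nullary using (¬_; Dec; yes; no; does; contradiction)
open import Relation.Nullary.Decidable using (_×-dec_; ¬?; dec-true; decidable-stable)
open import Relation.Unary using (Pred; Decidable)

open import Data.Nat.Solver using (module +-*-Solver)
open +-*-Solver using (solve; _:*_; _:+_; con; _:=_)

open import Defs

module _ {n : ℕ} where

  ⊆-∣∣-antisym : {p q : Subset n} → p ⊆ q → ∣ q ∣ ≤ ∣ p ∣ → p ≡ q
  ⊆-∣∣-antisym {p} {q} p⊆q ∣q∣≤∣p∣ = ⊆-antisym p⊆q q⊆p
    where
    q⊆p : q ⊆ p
    q⊆p {i} i∈q with i ∈? p
    ... | yes i∈p = i∈p
    ... | no i∉p = contradiction (p⊂q⇒∣p∣<∣q∣ (p⊆q , i , i∈q , i∉p)) (ℕ.≤⇒≯ ∣q∣≤∣p∣)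

  nested-∣∣-≡ : {p q : Subset n} → p ⊆ q ⊎ q ⊆ p → ∣ p ∣ ≡ ∣ q ∣ → p ≡ q
  nested-∣∣-≡ (inj₁ p⊆q) ∣p∣≡∣q∣ = ⊆-∣∣-antisym p⊆q (ℕ.≤-reflexive (sym ∣p∣≡∣q∣))
  nested-∣∣-≡ (inj₂ q⊆p) ∣p∣≡∣q∣ = sym (⊆-∣∣-antisym q⊆p (ℕ.≤-reflexive ∣p∣≡∣q∣))

  ∣p∩q∣<∣p∣ : {p q : Subset n} {i : Fin n} → i ∈ p → i ∉ q → ∣ p ∩ q ∣ < ∣ p ∣
  ∣p∩q∣<∣p∣ {p} {q} {i} i∈p i∉q = p⊂q⇒∣p∣<∣q∣ (p∩q⊆p p q , i , i∈p , i∉q ∘ proj₂ ∘ x∈p∩q⁻ p q)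

  x∈p⇒0<∣p∣ : {p : Subset n} {i : Fin n} → i ∈ p → 0 < ∣ p ∣
  x∈p⇒0<∣p∣ {p} {i} i∈p = subst (_< ∣ p ∣) (∣⊥∣≡0 n) (p⊂q⇒∣p∣<∣q∣ (⊥⊆ , i , i∈p , ∉⊥))

  ⊆-by-cases : {p q : Subset n} (d : Subset n) → p ∩ d ⊆ q → p ∩ ∁ d ⊆ q → p ⊆ q
  ⊆-by-cases {p} d in-d in-∁d {i} i∈p with i ∈? d
  ... | yes i∈d = in-d (x∈p∩q⁺ (i∈p , i∈d))
  ... | no i∉d = in-∁d (x∈p∩q⁺ (i∈p , x∉p⇒x∈∁p i∉d))

  select : {P : Pred (Fin n) 0ℓ} → Decidable P → Subset n
  select P? = tabulate (does ∘ P?)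

  ∈-select⁺ : {P : Pred (Fin n) 0ℓ} (P? : Decidable P) {i : Fin n} → P i → i ∈ select P?
  ∈-select⁺ P? {i} Pi = lookup⇒[]= i _ (trans (lookup∘tabulate (does ∘ P?) i) (dec-true (P? i) Pi))

  ∈-select⁻ : {P : Pred (Fin n) 0ℓ} (P? : Decidable P) {i : Fin n} → i ∈ select P? → P i
  ∈-select⁻ P? {i} i∈ with P? i | trans (sym (lookup∘tabulate (does ∘ P?) i)) ([]=⇒lookup i∈)
  ... | yes Pi | _ = Pi
  ... | no _ | ()

<⇒≱ : ∀ {p q : ℚ} → p <ℚ q → ¬ q ≤ℚ p
<⇒≱ p<q q≤p = ℚ.<-irrefl refl (ℚ.<-≤-trans p<q q≤p)

≤∧≢⇒< : ∀ {p q : ℚ} → p ≤ℚ q → p ≢ q → p <ℚ q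
≤∧≢⇒< {p} {q} p≤q p≢q with p <ℚ? q
... | yes p<q = p<q
... | no p≮q = contradiction (ℚ.≤-antisym p≤q (ℚ.≮⇒≥ p≮q)) p≢q

pred-as-Fin : ∀ {t s} → 0 < t → t < s + 2 → ∃ λ (k : Fin (s + 1)) → t ≡ suc (toℕ k)
pred-as-Fin {suc t} {s} _ 1+t<s+2 = fromℕ< t<s+1 , cong suc (sym (toℕ-fromℕ< t<s+1))
  where
  t<s+1 : t < s + 1
  t<s+1 = s<s⁻¹ (subst (suc t <_) (ℕ.+-suc s 1) 1+t<s+2)

argmax-or-none : ∀ {n} {P : Pred (Fin n) 0ℓ} → Decidable P → (f : Fin n → ℚ) →
  (∀ i → ¬ P i) ⊎ ∃ λ i → P i × ∀ {j} → P j → f j ≤ℚ f i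
argmax-or-none {zero} P? f = inj₁ λ ()
argmax-or-none {suc n} P? f with argmax-or-none (P? ∘ suc) (f ∘ suc) | P? zero
... | inj₁ none | no ¬P0 = inj₁ λ { zero → ¬P0 ; (suc i) → none i }
... | inj₁ none | yes P0 =
  inj₂ (zero , P0 , λ { {zero} _ → ℚ.≤-refl ; {suc j} Pj → contradiction Pj (none j) })
... | inj₂ (i , Pi , max) | no ¬P0 =
  inj₂ (suc i , Pi , λ { {zero} P0 → contradiction P0 ¬P0 ; {suc j} Pj → max Pj })
... | inj₂ (i , Pi , max) | yes P0 with ℚ.≤-total (f zero) (f (suc i))
...   | inj₁ f0≤fi = inj₂ (suc i , Pi , λ { {zero} _ → f0≤fi ; {suc j} Pj → max Pj })
...   | inj₂ fi≤f0 =
  inj₂ (zero , P0 , λ { {zero} _ → ℚ.≤-refl ; {suc j} Pj → ℚ.≤-trans (max Pj) fi≤f0 })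

lookup-injective : ∀ {A : Set} {xs : List A} → Unique xs → Injective _≡_ _≡_ (lookup xs)
lookup-injective (x∉xs ∷ _) {zero} {zero} _ = refl
lookup-injective (x∉xs ∷ _) {zero} {suc j} eq = contradiction eq (All.lookup x∉xs (∈-lookup j))
lookup-injective (x∉xs ∷ _) {suc i} {zero} eq = contradiction (sym eq) (All.lookup x∉xs (∈-lookup i))
lookup-injective (_ ∷ u) {suc i} {suc j} eq = cong suc (lookup-injective u eq)

unique-length-≤ : ∀ {A C : Set} {P : Pred A 0ℓ} {m} {xs : List A} → C ↔ Fin m →
  (code : ∀ {x} → P x → C) → (∀ {x y} (px : P x) (py : P y) → code px ≡ code py → x ≡ y) →
  Unique xs → All P xs → length xs ≤ m
unique-length-≤ {P = P} {xs = xs} C↔Fin code code-injective unique all =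
  injective⇒≤ {f = Inverse.to C↔Fin ∘ code ∘ P-at} λ eq →
    lookup-injective unique (code-injective _ _ (Injection.injective (↔⇒↣ C↔Fin) eq))
  where
  P-at : (i : Fin (length xs)) → P (lookup xs i)
  P-at i = All.lookup all (∈-lookup {xs = xs} i)

record Interval {n ℓ} (_⊑_ : Rel (Fin n) ℓ) (T : Pred (Fin n) 0ℓ) (S : Subset n) : Set ℓ where
  field
    ⊆T     : ∀ {i} → i ∈ S → T i
    convex : ∀ {a i b} → a ∈ S → b ∈ S → T i → a ⊑ i → i ⊑ b → i ∈ S
open Interval

UpperBoundIn : ∀ {n ℓ} → Rel (Fin n) ℓ → Subset n → Subset n → Set ℓ
UpperBoundIn _⊑_ S D = ∃ λ u → u ∈ S × ∀ {j} → j ∈ D → j ⊑ u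

LowerBoundIn : ∀ {n ℓ} → Rel (Fin n) ℓ → Subset n → Subset n → Set ℓ
LowerBoundIn _⊑_ = UpperBoundIn (flip _⊑_)

module _ {n ℓ} {_⊑_ : Rel (Fin n) ℓ} {T : Pred (Fin n) 0ℓ} where

  Interval-flip : {S : Subset n} → Interval _⊑_ T S → Interval (flip _⊑_) T S
  Interval-flip I = record
    { ⊆T = ⊆T I
    ; convex = λ a∈S b∈S Ti i⊒a b⊒i → convex I b∈S a∈S Ti b⊒i i⊒a
    }

  module _ (⊑-total : Total _⊑_) {S S′ D : Subset n}
           (I : Interval _⊑_ T S) (I′ : Interval _⊑_ T S′) where

    -- Since i ⊑ u′ ∈ S′ but i ∉ S′, convexity of S′ puts i below every element of S′;
    -- hence S′ ∩ D lies between i and u, inside S.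
    lower-part-⊆ : UpperBoundIn _⊑_ S D → UpperBoundIn _⊑_ S′ D →
                   ∀ {i} → i ∈ S ∩ D → i ∉ S′ → S′ ∩ D ⊆ S ∩ D
    lower-part-⊆ (u , u∈S , D⊑u) (u′ , u′∈S′ , D⊑u′) {i} i∈S∩D i∉S′ {j} j∈S′∩D
      with x∈p∩q⁻ S D i∈S∩D | x∈p∩q⁻ S′ D j∈S′∩D
    ... | i∈S , i∈D | j∈S′ , j∈D = x∈p∩q⁺ (convex I i∈S u∈S (⊆T I′ j∈S′) i⊑j (D⊑u j∈D) , j∈D)
      where
      i⊑j : i ⊑ j
      i⊑j with ⊑-total i j
      ... | inj₁ i⊑j = i⊑j
      ... | inj₂ j⊑i = contradiction (convex I′ j∈S′ u′∈S′ (⊆T I i∈S) j⊑i (D⊑u′ i∈D)) i∉S′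

    lower-parts-nested : UpperBoundIn _⊑_ S D → UpperBoundIn _⊑_ S′ D →
                         S ∩ D ⊆ S′ ∩ D ⊎ S′ ∩ D ⊆ S ∩ D
    lower-parts-nested ub ub′ with any? (λ i → (i ∈? S ∩ D) ×-dec ¬? (i ∈? S′))
    ... | yes (i , i∈S∩D , i∉S′) = inj₂ (lower-part-⊆ ub ub′ i∈S∩D i∉S′)
    ... | no ∄ = inj₁ λ {i} i∈S∩D →
      x∈p∩q⁺ (decidable-stable (i ∈? S′) (λ i∉S′ → ∄ (i , i∈S∩D , i∉S′)) , proj₂ (x∈p∩q⁻ S D i∈S∩D))

module _ {n ℓ} {_⊑_ : Rel (Fin n) ℓ} {T : Pred (Fin n) 0ℓ} {S S′ D : Subset n} where

  -- The upper parts S ∩ ∁ D are compared by lower-parts-nested for the reversed order.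
  interval-unique : Total _⊑_ → Interval _⊑_ T S → Interval _⊑_ T S′ →
    UpperBoundIn _⊑_ S D → UpperBoundIn _⊑_ S′ D →
    LowerBoundIn _⊑_ S (∁ D) → LowerBoundIn _⊑_ S′ (∁ D) →
    ∣ S ∩ D ∣ ≡ ∣ S′ ∩ D ∣ → ∣ S ∣ ≡ ∣ S′ ∣ → S ≡ S′
  interval-unique ⊑-total I I′ ub ub′ lb lb′ ∣S∩D∣≡ ∣S∣≡ = nested-∣∣-≡ S-nested ∣S∣≡
    where
    lower-parts : S ∩ D ≡ S′ ∩ D
    lower-parts = nested-∣∣-≡ (lower-parts-nested ⊑-total I I′ ub ub′) ∣S∩D∣≡

    glue : ∀ {R R′} → R ∩ D ≡ R′ ∩ D → R ∩ ∁ D ⊆ R′ ∩ ∁ D → R ⊆ R′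
    glue {R} {R′} lower upper = ⊆-by-cases D
      (p∩q⊆p R′ D ∘ subst (_ ∈_) lower) (p∩q⊆p R′ (∁ D) ∘ upper)

    S-nested : S ⊆ S′ ⊎ S′ ⊆ S
    S-nested = Sum.map (glue lower-parts) (glue (sym lower-parts))
      (lower-parts-nested (flip ⊑-total) (Interval-flip I) (Interval-flip I′) lb lb′)

module BarGeometry {n : ℕ} (B : BarCollection n) where

  h l r : Fin n → ℚ
  h i = height (bar B i)
  l i = left (bar B i)
  r i = right (bar B i)

  _⊑_ : Rel (Fin n) 0ℓ
  i ⊑ j = h i ≤ℚ h j

  ⊑-total : Total _⊑_
  ⊑-total i j = ℚ.≤-total (h i) (h j)

  Covers : ℚ → Pred (Fin n) 0ℓ
  Covers x i = l i ≤ℚ x × x ≤ℚ r i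

  covering-heights-distinct : ∀ {x i j} → Covers x i → Covers x j → i ≢ j → h i ≢ h j
  covering-heights-distinct {i = i} {j} (li≤x , x≤ri) (lj≤x , x≤rj) i≢j
    with pairwiseDisjoint B i j i≢j
  ... | inj₁ hi≢hj = hi≢hj
  ... | inj₂ (inj₁ ri<lj) = contradiction (ℚ.≤-trans lj≤x x≤ri) (<⇒≱ ri<lj)
  ... | inj₂ (inj₂ rj<li) = contradiction (ℚ.≤-trans li≤x x≤rj) (<⇒≱ rj<li)

  below : ℚ → Subset n
  below q = select (λ i → h i <ℚ? q)

  ∈-below⁺ : ∀ {q i} → h i <ℚ q → i ∈ below q
  ∈-below⁺ {q} = ∈-select⁺ (λ i → h i <ℚ? q)

  ∈-below⁻ : ∀ {q i} → i ∈ below q → h i <ℚ q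
  ∈-below⁻ {q} = ∈-select⁻ (λ i → h i <ℚ? q)

  Straddles : Subset n → ℚ → Set
  Straddles S q = (∃ λ d → d ∈ S × h d ≤ℚ q) × (∃ λ u → u ∈ S × q ≤ℚ h u)

  straddles? : ∀ S q → Dec (Straddles S q)
  straddles? S q =
    any? (λ d → (d ∈? S) ×-dec (h d ≤ℚ? q)) ×-dec any? (λ u → (u ∈? S) ×-dec (q ≤ℚ? h u))

  member-straddles : ∀ {S a} → a ∈ S → Straddles S (h a)
  member-straddles {a = a} a∈S = (a , a∈S , ℚ.≤-refl) , (a , a∈S , ℚ.≤-refl)

  straddles⇒upperBound : ∀ {S q} → Straddles S q → UpperBoundIn _⊑_ S (below q)
  straddles⇒upperBound (_ , u , u∈S , q≤hu) =
    u , u∈S , λ j∈below → ℚ.<⇒≤ (ℚ.<-≤-trans (∈-below⁻ j∈below) q≤hu)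

  straddles⇒lowerBound : ∀ {S q} → Straddles S q → LowerBoundIn _⊑_ S (∁ (below q))
  straddles⇒lowerBound ((d , d∈S , hd≤q) , _) =
    d , d∈S , λ j∈∁below → ℚ.≤-trans hd≤q (ℚ.≮⇒≥ (x∈∁p⇒x∉p j∈∁below ∘ ∈-below⁺))

  straddles⇒∣below∣<∣∣ : ∀ {S q} → Straddles S q → ∣ S ∩ below q ∣ < ∣ S ∣
  straddles⇒∣below∣<∣∣ (_ , u , u∈S , q≤hu) = ∣p∩q∣<∣p∣ u∈S (flip <⇒≱ q≤hu ∘ ∈-below⁻)

  interval-unique-at : ∀ {x q S S′} → Interval _⊑_ (Covers x) S → Interval _⊑_ (Covers x) S′ →
    Straddles S q → Straddles S′ q → ∣ S ∩ below q ∣ ≡ ∣ S′ ∩ below q ∣ → ∣ S ∣ ≡ ∣ S′ ∣ → S ≡ S′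
  interval-unique-at I I′ st st′ = interval-unique ⊑-total I I′
    (straddles⇒upperBound st) (straddles⇒upperBound st′)
    (straddles⇒lowerBound st) (straddles⇒lowerBound st′)

  Code : ℕ → Set
  Code s = Fin n × (Fin (s + 2) ⊎ Fin (s + 1))

  Charged : (s : ℕ) → Subset n → Code s → Set
  Charged s S (a , inj₁ k) =
    Interval _⊑_ (Covers (l a)) S × Straddles S (h a) × ∣ S ∩ below (h a) ∣ ≡ toℕ k
  Charged s S (c , inj₂ k) =
    (∃ λ x₀ → r c <ℚ x₀ × ∀ x → r c <ℚ x → x ≤ℚ x₀ → Interval _⊑_ (Covers x) S) ×
    Straddles S (h c) × ∣ S ∩ below (h c) ∣ ≡ suc (toℕ k)

  Code↔Fin : ∀ s → Code s ↔ Fin (n * (s + 2 + (s + 1)))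
  Code↔Fin s = ↔-trans (↔-refl ×-↔ ↔-sym +↔⊎) (↔-sym *↔×)

  charged-injective : ∀ {s S S′} (κ : Code s) →
                      Charged s S κ → Charged s S′ κ → ∣ S ∣ ≡ ∣ S′ ∣ → S ≡ S′
  charged-injective (a , inj₁ k) (I , st , ∣∣≡k) (I′ , st′ , ∣∣′≡k) =
    interval-unique-at I I′ st st′ (trans ∣∣≡k (sym ∣∣′≡k))
  charged-injective (c , inj₂ k) ((x₀ , rc<x₀ , I) , st , ∣∣≡k) ((x₀′ , rc<x₀′ , I′) , st′ , ∣∣′≡k)
    with ℚ.≤-total x₀ x₀′
  ... | inj₁ x₀≤x₀′ =
    interval-unique-at (I x₀ rc<x₀ ℚ.≤-refl) (I′ x₀ rc<x₀ x₀≤x₀′) st st′ (trans ∣∣≡k (sym ∣∣′≡k))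
  ... | inj₂ x₀′≤x₀ =
    interval-unique-at (I x₀′ rc<x₀′ x₀′≤x₀) (I′ x₀′ rc<x₀′ ℚ.≤-refl) st st′ (trans ∣∣≡k (sym ∣∣′≡k))

  module EdgeSweep (s : ℕ) {S : Subset n} (∣S∣≡s+2 : ∣ S ∣ ≡ s + 2) (σ : VSeg)
                   (exact : ∀ i → (i ∈ S → Meets σ (bar B i)) × (Meets σ (bar B i) → i ∈ S)) where

    x₀ : ℚ
    x₀ = x σ

    l≤x₀ : ∀ {i} → i ∈ S → l i ≤ℚ x₀
    l≤x₀ {i} i∈S = proj₁ (proj₁ (proj₁ (exact i) i∈S))

    x₀≤r : ∀ {i} → i ∈ S → x₀ ≤ℚ r i
    x₀≤r {i} i∈S = proj₂ (proj₁ (proj₁ (exact i) i∈S))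

    between-heights-of-S : ∀ {a i b} → a ∈ S → b ∈ S → a ⊑ i → i ⊑ b →
                           bottom σ ≤ℚ h i × h i ≤ℚ top σ
    between-heights-of-S {a} {i} {b} a∈S b∈S ha≤hi hi≤hb =
      ℚ.≤-trans (proj₁ (proj₂ (proj₁ (exact a) a∈S))) ha≤hi ,
      ℚ.≤-trans hi≤hb (proj₂ (proj₂ (proj₁ (exact b) b∈S)))

    Blocker : Pred (Fin n) 0ℓ
    Blocker c = r c <ℚ x₀ × Straddles S (h c)

    blocker? : Decidable Blocker
    blocker? c = (r c <ℚ? x₀) ×-dec straddles? S (h c)

    -- A bar between two bars of S over x and missing from S would meet σ unless it ends
    -- before x₀, that is, unless it is a blocker.
    sweep : ∀ {x} → x ≤ℚ x₀ → (∀ {i} → i ∈ S → l i ≤ℚ x) → (∀ {c} → Blocker c → r c <ℚ x) →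
            Interval _⊑_ (Covers x) S
    sweep {x} x≤x₀ S-left no-blocker = record
      { ⊆T = λ i∈S → S-left i∈S , ℚ.≤-trans x≤x₀ (x₀≤r i∈S)
      ; convex = between
      }
      where
      between : ∀ {a i b} → a ∈ S → b ∈ S → Covers x i → a ⊑ i → i ⊑ b → i ∈ S
      between {a} {i} {b} a∈S b∈S (li≤x , x≤ri) ha≤hi hi≤hb with r i <ℚ? x₀
      ... | yes ri<x₀ =
            contradiction x≤ri (<⇒≱ (no-blocker (ri<x₀ , (a , a∈S , ha≤hi) , (b , b∈S , hi≤hb))))
      ... | no ri≮x₀ = proj₂ (exact i)
            ((ℚ.≤-trans li≤x x≤x₀ , ℚ.≮⇒≥ ri≮x₀) , between-heights-of-S a∈S b∈S ha≤hi hi≤hb)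

    ∣below∣<s+2 : ∀ {q} → Straddles S q → ∣ S ∩ below q ∣ < s + 2
    ∣below∣<s+2 {q} st = subst (∣ S ∩ below q ∣ <_) ∣S∣≡s+2 (straddles⇒∣below∣<∣∣ st)

    charged-at-left-end : ∀ {a} → a ∈ S → (∀ {i} → i ∈ S → l i ≤ℚ l a) →
                          (∀ {c} → Blocker c → r c <ℚ l a) → ∃ (Charged s S)
    charged-at-left-end {a} a∈S S-left no-blocker =
      (a , inj₁ (fromℕ< ∣below∣<)) ,
      sweep (l≤x₀ a∈S) S-left no-blocker ,
      member-straddles a∈S ,
      sym (toℕ-fromℕ< ∣below∣<)
      where
      ∣below∣< : ∣ S ∩ below (h a) ∣ < s + 2
      ∣below∣< = ∣below∣<s+2 (member-straddles a∈S)

    -- The bars of S and c all cover the right end of c.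
    blocker-height-fresh : ∀ {c d} → (∀ {i} → i ∈ S → l i ≤ℚ r c) → r c <ℚ x₀ → d ∈ S → h d ≢ h c
    blocker-height-fresh {c} {d} S-left rc<x₀ d∈S =
      covering-heights-distinct (S-left d∈S , ℚ.≤-trans (ℚ.<⇒≤ rc<x₀) (x₀≤r d∈S))
                                (ℚ.<⇒≤ (left<right (bar B c)) , ℚ.≤-refl) d≢c
      where
      d≢c : d ≢ c
      d≢c refl = <⇒≱ rc<x₀ (x₀≤r d∈S)

    blocker-below-nonempty : ∀ {c} → Blocker c → (∀ {i} → i ∈ S → l i ≤ℚ r c) →
                             0 < ∣ S ∩ below (h c) ∣
    blocker-below-nonempty (rc<x₀ , (d , d∈S , hd≤hc) , _) S-left = x∈p⇒0<∣p∣ (x∈p∩q⁺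
      (d∈S , ∈-below⁺ (≤∧≢⇒< hd≤hc (blocker-height-fresh S-left rc<x₀ d∈S))))

    charged-at-blocker : ∀ {c} → Blocker c → (∀ {d} → Blocker d → r d ≤ℚ r c) →
                         (∀ {i} → i ∈ S → l i ≤ℚ r c) → ∃ (Charged s S)
    charged-at-blocker {c} bc@(rc<x₀ , st) c-max S-left
      with pred-as-Fin (blocker-below-nonempty bc S-left) (∣below∣<s+2 st)
    ... | k , ∣below∣≡1+k =
      (c , inj₂ k) ,
      (x₀ , rc<x₀ , λ x rc<x x≤x₀ →
        sweep x≤x₀ (λ i∈S → ℚ.≤-trans (S-left i∈S) (ℚ.<⇒≤ rc<x)) (λ bd → ℚ.≤-<-trans (c-max bd) rc<x)) ,
      st , ∣below∣≡1+k

    charged : ∃ (Charged s S)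
    charged with argmax-or-none (_∈? S) l
    ... | inj₁ S-empty = contradiction (trans (sym ∣S∣≡s+2) ∣S∣≡0) (ℕ.m+1+n≢0 s)
      where
      ∣S∣≡0 : ∣ S ∣ ≡ 0
      ∣S∣≡0 = trans (cong ∣_∣ (Empty-unique λ (i , i∈S) → S-empty i i∈S)) (∣⊥∣≡0 n)
    ... | inj₂ (a , a∈S , a-max) with argmax-or-none blocker? r
    ...   | inj₁ none = charged-at-left-end a∈S a-max (λ {c} bc → contradiction bc (none c))
    ...   | inj₂ (c , bc , c-max) with r c <ℚ? l a
    ...     | yes rc<la = charged-at-left-end a∈S a-max (λ bd → ℚ.≤-<-trans (c-max bd) rc<la)
    ...     | no rc≮la = charged-at-blocker bc c-max (λ i∈S → ℚ.≤-trans (a-max i∈S) (ℚ.≮⇒≥ rc≮la))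

  charge : ∀ {s S} → IsEdge s B S → ∃ (Charged s S)
  charge {s} (∣S∣≡s+2 , σ , exact) = EdgeSweep.charged s ∣S∣≡s+2 σ exact

  charge-injective : ∀ {s S S′} (e : IsEdge s B S) (e′ : IsEdge s B S′) →
                     proj₁ (charge e) ≡ proj₁ (charge e′) → S ≡ S′
  charge-injective {s} {S} e@(∣S∣≡s+2 , _) e′@(∣S′∣≡s+2 , _) eq =
    charged-injective (proj₁ (charge e′))
      (subst (Charged s S) eq (proj₂ (charge e))) (proj₂ (charge e′)) (trans ∣S∣≡s+2 (sym ∣S′∣≡s+2))

number-of-codes : ∀ s n → n * (s + 2 + (s + 1)) ≡ (2 * s + 3) * n
number-of-codes =
  solve 2 (λ s n → n :* ((s :+ con 2) :+ (s :+ con 1)) := (con 2 :* s :+ con 3) :* n) refl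

mainTheorem8 : (s n : ℕ) (B : BarCollection n) (E : List (Subset n)) →
    Unique E → All (IsEdge s B) E → length E ≤ (2 * s + 3) * n
mainTheorem8 s n B E unique edges =
  subst (length E ≤_) (number-of-codes s n)
    (unique-length-≤ (Code↔Fin s) (proj₁ ∘ charge) charge-injective unique edges)
  where
  open BarGeometry B
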